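{- Let $f:x\to y$ be an isomorphism in a wild category. Then the type $\mathrm{Sec}(f):=\sum_{g:y\to x} f\circ g=\mathrm{id}_y$ of sections of $f$ is contractible.
   Context: Working in intensional Martin-Löf type theory (without function extensionality). A wild category $\mathcal C$ consists of a type $\mathcal C_0$ of objects, a family of types $\mathcal C_1(x,y)$ of morphisms, composites $g\circ f$, identities $\mathrm{id}_x$, associator paths $h\circ(g\circ f)=(h\circ g)\circ f$ and unitor paths $\mathrm{id}\circ f=f$, $f\circ\mathrm{id}=f$. A morphism $f:x\to y$ is an isomorphism if it has a section ($g$ with a path $f\circ g=\mathrm{id}_y$) and a retraction ($r$ with a path $r\circ f=\mathrm{id}_x$). -}

{-# OPTIONS --without-K #-}
module Defs where

open import Level using (Level; _⊔_; suc)
open import Data.Product using (Σ; _×_; _,_)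
open import Relation.Binary.PropositionalEquality using (_≡_)

record WildCat (o h : Level) : Set (suc (o ⊔ h)) where
  field
    Ob    : Set o
    Hom   : Ob → Ob → Set h
    _∘_   : {x y z : Ob} → Hom y z → Hom x y → Hom x z
    idc   : (x : Ob) → Hom x x
    assoc : {w x y z : Ob} (h : Hom y z) (g : Hom x y) (f : Hom w x)
          → h ∘ (g ∘ f) ≡ (h ∘ g) ∘ f
    idl   : {x y : Ob} (f : Hom x y) → idc y ∘ f ≡ f
    idr   : {x y : Ob} (f : Hom x y) → f ∘ idc x ≡ f

isContr : {ℓ : Level} → Set ℓ → Set ℓ
isContr A = Σ A (λ c → (a : A) → c ≡ a)

module _ {o h : Level} (C : WildCat o h) where
  open WildCat C

  Sec : {x y : Ob} → Hom x y → Set h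
  Sec {x} {y} f = Σ (Hom y x) (λ g → f ∘ g ≡ idc y)

  Retr : {x y : Ob} → Hom x y → Set h
  Retr {x} {y} f = Σ (Hom y x) (λ r → r ∘ f ≡ idc x)

  isIso : {x y : Ob} → Hom x y → Set h
  isIso f = Sec f × Retr f

{-# OPTIONS --safe #-}
{-# OPTIONS --without-K #-}

-- Sec f is the fibre of postcomposition f ∘_ : Hom y x → Hom y y over idc y.
-- If f has a retraction r and a section g then r = g, so f ∘_ has the
-- two-sided inverse r ∘_; promoting this inverse to a half adjoint
-- equivalence (HoTT book, §4.2) makes all its fibres contractible.
module Submission where

open import Level using (Level; _⊔_)
open import Data.Product using (Σ; _,_)
open import Function.Bundles using (_↔_; mk↔ₛ′)
open import Function.Properties.Inverse.HalfAdjointEquivalence using (_≃_; ↔⇒≃)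
open import Relation.Binary.PropositionalEquality
  using (_≡_; refl; sym; trans; cong; trans-reflʳ; module ≡-Reasoning)
open import Defs

private
  variable
    a b : Level
    A : Set a
    B : Set b

Fibre : {A : Set a} {B : Set b} → (A → B) → B → Set (a ⊔ b)
Fibre {A = A} φ y = Σ A (λ x → φ x ≡ y)

module _ (φ : A → B) {y : B} where

  Fibre-≡ : {u v : A} (q : u ≡ v) {s : φ u ≡ y} {t : φ v ≡ y}
          → s ≡ trans (cong φ q) t → _≡_ {A = Fibre φ y} (u , s) (v , t)
  Fibre-≡ refl refl = refl

module _ (e : A ≃ B) where
  open _≃_ e

  ≃⇒isContr-Fibre : (y : B) → isContr (Fibre to y)
  ≃⇒isContr-Fibre y = (from y , right-inverse-of y) , contraction
    where
    contraction : (p : Fibre to y) → (from y , right-inverse-of y) ≡ p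
    contraction (x , refl) =
      Fibre-≡ to (left-inverse-of x)
        (sym (trans (trans-reflʳ (cong to (left-inverse-of x))) (left-right x)))

module _ {o h : Level} (C : WildCat o h) where
  open WildCat C

  ∘-retract : {x y : Ob} {u : Hom y x} {v : Hom x y} → u ∘ v ≡ idc x
            → {w : Ob} (k : Hom w x) → u ∘ (v ∘ k) ≡ k
  ∘-retract {u = u} {v} uv≡id k = begin
    u ∘ (v ∘ k)  ≡⟨ assoc u v k ⟩
    (u ∘ v) ∘ k  ≡⟨ cong (_∘ k) uv≡id ⟩
    idc _ ∘ k    ≡⟨ idl k ⟩
    k            ∎
    where open ≡-Reasoning

  retraction≡section : {x y : Ob} {f : Hom x y} {r g : Hom y x}
                     → r ∘ f ≡ idc x → f ∘ g ≡ idc y → r ≡ g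
  retraction≡section {f = f} {r} {g} rf≡id fg≡id = begin
    r            ≡⟨ sym (idr r) ⟩
    r ∘ idc _    ≡⟨ cong (r ∘_) (sym fg≡id) ⟩
    r ∘ (f ∘ g)  ≡⟨ ∘-retract rf≡id g ⟩
    g            ∎
    where open ≡-Reasoning

  isIso⇒postcomp-↔ : {x y : Ob} {f : Hom x y} → isIso C f
                   → {w : Ob} → Hom w x ↔ Hom w y
  isIso⇒postcomp-↔ {f = f} ((g , fg≡id) , (r , rf≡id)) =
    mk↔ₛ′ (f ∘_) (r ∘_) (∘-retract fr≡id) (∘-retract rf≡id)
    where
    fr≡id : f ∘ r ≡ idc _
    fr≡id = trans (cong (f ∘_) (retraction≡section rf≡id fg≡id)) fg≡id

lemma2p6 : {o h : Level} (C : WildCat o h) {x y : WildCat.Ob C}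
    (f : WildCat.Hom C x y) → isIso C f → isContr (Sec C f)
lemma2p6 C {y = y} f f-iso =
  ≃⇒isContr-Fibre (↔⇒≃ (isIso⇒postcomp-↔ C f-iso)) (WildCat.idc C y)
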